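{- Let $n\ge1$, $N=\{0,\dots,2n-1\}$, and let $G=(N,w)$ be a closed integer octagonal graph such that $G^{\mathrm T}=(N,w^{\mathrm T}) := \mathrm{T\text{ - }closure}(G)$ is an octagonal graph (i.e., is not $\bot$). Then for all $z_1,z_2\in N$ at least one of the following holds: \[ w^{\mathrm T}(z_1,z_2) = w(z_1,z_2), \qquad w^{\mathrm T}(z_1,z_2) = \Bigl\lfloor \tfrac{w(z_1,\bar z_1)}{2}\Bigr\rfloor + \Bigl\lfloor \tfrac{w(\bar z_2,z_2)}{2}\Bigr\rfloor . \]
   Context: Weights lie in $\mathbb{Q}_\infty=\mathbb{Q}\cup\{+\infty\}$ with $d<+\infty$ for $d\in\mathbb{Q}$; $\lfloor+\infty/2\rfloor=+\infty$, $+\infty+d=+\infty$. A graph on a finite node set $N$ is a pair $(N,w)$, $w:N\times N\to\mathbb{Q}_\infty$; $(a,b)$ is an arc if $w(a,b)<+\infty$; a graph is consistent if it has no cycle of negative weight. $(N,w_1)\unlhd(N,w_2)$ iff $w_1\le w_2$ pointwise. A consistent graph is closed if $w(a,a)=0$ and $w(a,b)\le w(a,c)+w(c,b)$ for all $a,b,c$. For $i\in N=\{0,\dots,2n-1\}$, $\bar\imath=i+1$ if $i$ even, $i-1$ if $i$ odd. An octagonal graph is a consistent graph $(N,w)$ with $w(i,j)=w(\bar\jmath,\bar\imath)$ for all $i,j$; an integer octagonal graph additionally has all weights in $\mathbb{Z}\cup\{+\infty\}$. An octagonal graph is strongly closed if closed and $2w(i,j)\le w(i,\bar\imath)+w(\bar\jmath,j)$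 for all $i,j$; it is tightly closed if it is a strongly closed integer octagonal graph with $w(i,\bar\imath)$ even (or $+\infty$) for all $i$. $\mathrm{T\text{ - }closure}(G)$ is the least upper bound (pointwise maximum) of all tightly closed octagonal graphs $G'\unlhd G$ in the lattice of octagonal graphs with an added bottom element $\bot$; the least upper bound of the empty set is $\bot$. -}

module Defs where

open import Data.Nat using (ℕ; zero; suc)
open import Data.Fin using (Fin; zero; suc)
open import Data.Integer using (ℤ)
open import Data.Rational using (ℚ; 0ℚ; ½; floor; _/_) renaming (_+_ to _+ℚ_; _*_ to _*ℚ_; _≤_ to _≤ℚ_)
open import Data.List using (List; []; _∷_)
open import Data.Product using (Σ; ∃; _×_; _,_)
open import Data.Sum using (_⊎_)
open import Relation.Binary.PropositionalEquality using (_≡_)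

data ℚ∞ : Set where
  fin : ℚ → ℚ∞
  ∞ : ℚ∞

infix 4 _≤∞_
data _≤∞_ : ℚ∞ → ℚ∞ → Set where
  fin≤fin : ∀ {p q} → p ≤ℚ q → fin p ≤∞ fin q
  ≤∞∞ : ∀ {x} → x ≤∞ ∞

infixl 6 _+∞_
_+∞_ : ℚ∞ → ℚ∞ → ℚ∞
fin p +∞ fin q = fin (p +ℚ q)
fin p +∞ ∞ = ∞
∞ +∞ _ = ∞

twice : ℚ∞ → ℚ∞
twice x = x +∞ x

halfFloor : ℚ∞ → ℚ∞
halfFloor (fin q) = fin (floor (q *ℚ ½) / 1)
halfFloor ∞ = ∞

IsIntW : ℚ∞ → Set
IsIntW x = (Σ ℤ λ z → x ≡ fin (z / 1)) ⊎ (x ≡ ∞)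

IsEvenW : ℚ∞ → Set
IsEvenW x = (Σ ℤ λ z → x ≡ fin ((z Data.Integer.+ z) / 1)) ⊎ (x ≡ ∞)

dbl : ℕ → ℕ
dbl zero    = zero
dbl (suc n) = suc (suc (dbl n))

Node : ℕ → Set
Node n = Fin (dbl n)

-- ī = i+1 if i even, i-1 if i odd
bar : ∀ {n} → Node n → Node n
bar {suc n} zero          = suc zero
bar {suc n} (suc zero)    = zero
bar {suc n} (suc (suc i)) = suc (suc (bar {n} i))

Graph : ℕ → Set
Graph n = Node n → Node n → ℚ∞

-- weight of the path v₀ → v₁ → … → v_k → t
pathW : ∀ {n} → Graph n → Node n → List (Node n) → Node n → ℚ∞
pathW w a []       t = w a t
pathW w a (b ∷ bs) t = w a b +∞ pathW w b bs t

cycleW : ∀ {n} → Graph n → Node n → List (Node n) → ℚ∞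
cycleW w v vs = pathW w v vs v

Consistent : ∀ {n} → Graph n → Set
Consistent w = ∀ v vs → fin 0ℚ ≤∞ cycleW w v vs

_⊴_ : ∀ {n} → Graph n → Graph n → Set
w₁ ⊴ w₂ = ∀ i j → w₁ i j ≤∞ w₂ i j

Closed : ∀ {n} → Graph n → Set
Closed w = Consistent w × (∀ a → w a a ≡ fin 0ℚ)
         × (∀ a b c → w a b ≤∞ w a c +∞ w c b)

Octagonal : ∀ {n} → Graph n → Set
Octagonal w = Consistent w × (∀ i j → w i j ≡ w (bar j) (bar i))

IntOctagonal : ∀ {n} → Graph n → Set
IntOctagonal w = Octagonal w × (∀ i j → IsIntW (w i j))

StronglyClosed : ∀ {n} → Graph n → Set
StronglyClosed w = Octagonal w × Closed w
  × (∀ i j → twice (w i j) ≤∞ w i (bar i) +∞ w (bar j) j)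

TightlyClosed : ∀ {n} → Graph n → Set
TightlyClosed w = StronglyClosed w × IntOctagonal w × (∀ i → IsEvenW (w i (bar i)))

TBelow : ∀ {n} → Graph n → Graph n → Set
TBelow w w' = TightlyClosed w' × (w' ⊴ w)

-- T-closure(G) = wT (≠ ⊥): the set {G' tightly closed, G' ⊴ G} is nonempty
-- and wT is its pointwise least upper bound (pointwise maximum).
IsTClosure : ∀ {n} → Graph n → Graph n → Set
IsTClosure w wT =
  (∃ λ w' → TBelow w w')
  × (∀ i j → (∀ w' → TBelow w w' → w' i j ≤∞ wT i j)
           × (∀ d → (∀ w' → TBelow w w' → w' i j ≤∞ d) → wT i j ≤∞ d))

-- If G = (N, w) is closed and integer octagonal, its T-closure (when not ⊥)
-- is the candidate graph  M(i,j) = min (W(i,j), h(i,j)),  where W is w read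
-- in extended integers and h(i,j) = ⌊W(i,ī)/2⌋ + ⌊W(j̄,j)/2⌋.
--   * Every tightly closed G' ⊴ G lies below M: the even weight w'(i,ī) = 2e
--     is at most W(i,ī), so e ≤ ⌊W(i,ī)/2⌋, and strong closure
--     2w'(i,j) ≤ w'(i,ī) + w'(j̄,j) halves to w'(i,j) ≤ h(i,j).
--   * If some tightly closed G' ⊴ G exists then h(c,c) ≥ 0 (cycle c → c̄ → c),
--     and M itself is tightly closed and below G.
-- So T-closure(G) = M, and min selects one of its two arguments.

module Submission where

open import Defs
open import Data.Nat using (ℕ; _≤_)
open import Data.Sum using (_⊎_)
open import Relation.Binary.PropositionalEquality using (_≡_)

open import Level using (0ℓ)
open import Data.Nat as ℕ using (suc)
import Data.Fin as Fin
open import Data.Integer as ℤ using (ℤ; +_)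
import Data.Integer.Properties as ℤP
import Data.Integer.DivMod as ℤD
open import Data.Integer.Tactic.RingSolver using (solve-∀)
open import Data.Rational as ℚ using (ℚ; mkℚ; _/_; ↥_; ↧_; floor; ½; 0ℚ)
import Data.Rational.Properties as ℚP
import Data.Rational.Unnormalised as ℚᵘ
open import Data.Nat.Coprimality as Coprimality using (1-coprimeTo)
open import Data.Product using (Σ; _×_; _,_; proj₁; proj₂)
import Data.Sum as Sum
open import Data.List using ([]; _∷_)
open import Relation.Binary.PropositionalEquality
  using (refl; sym; trans; cong; cong₂; subst; subst₂; isEquivalence; module ≡-Reasoning)
open import Relation.Nullary using (yes; no)
open import Data.Empty using (⊥-elim)
open import Relation.Binary.Bundles using (TotalPreorder)
open import Relation.Binary.Structures using (IsTotalOrder)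
open import Relation.Nullary.Construct.Add.Supremum using (⊤⁺; _⁺; [_])
open import Relation.Binary.Construct.Add.Supremum.NonStrict ℤ._≤_
  using (_≤⁺_; [_]; _≤⊤⁺; ≤⁺-isTotalOrder-≡)
open import Algebra.Bundles using (CommutativeSemigroup)
open import Algebra.Construct.NaturalChoice.Base using (MinOperator)
import Algebra.Construct.NaturalChoice.MinOp as MinOp
import Algebra.Properties.CommutativeSemigroup as CommutativeSemigroupProperties

integral : ℤ → ℚ
integral z = mkℚ z 0 (Coprimality.sym (1-coprimeTo ℤ.∣ z ∣))

z/1≡integral : ∀ z → z / 1 ≡ integral z
z/1≡integral z = ℚP.↥p/↧p≡p (integral z)

/1-+ : ∀ x y → (x / 1) ℚ.+ (y / 1) ≡ (x ℤ.+ y) / 1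
/1-+ x y = trans (cong₂ ℚ._+_ (z/1≡integral x) (z/1≡integral y))
  (cong (_/ 1) (cong₂ ℤ._+_ (ℤP.*-identityʳ x) (ℤP.*-identityʳ y)))

/1-mono-≤ : ∀ {x y} → x ℤ.≤ y → (x / 1) ℚ.≤ (y / 1)
/1-mono-≤ {x} {y} le rewrite z/1≡integral x | z/1≡integral y =
  ℚ.*≤* (subst₂ ℤ._≤_ (sym (ℤP.*-identityʳ x)) (sym (ℤP.*-identityʳ y)) le)

/1-cancel-≤ : ∀ {x y} → (x / 1) ℚ.≤ (y / 1) → x ℤ.≤ y
/1-cancel-≤ {x} {y} le rewrite z/1≡integral x | z/1≡integral y with le
... | ℚ.*≤* l = subst₂ ℤ._≤_ (ℤP.*-identityʳ x) (ℤP.*-identityʳ y) l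

↥*↧ : ∀ p q → ↥ (p ℚ.* q) ℤ.* (↧ p ℤ.* ↧ q) ≡ (↥ p ℤ.* ↥ q) ℤ.* ↧ (p ℚ.* q)
↥*↧ p@record{} q@record{} with ℚP.toℚᵘ-homo-* p q
... | ℚᵘ.*≡* eq = subst₂ (λ a d → a ℤ.* (↧ p ℤ.* ↧ q) ≡ (↥ p ℤ.* ↥ q) ℤ.* d)
  (ℚP.↥ᵘ-toℚᵘ (p ℚ.* q)) (ℚP.↧ᵘ-toℚᵘ (p ℚ.* q)) eq

-- ⌊z/2⌋, written so that  halfFloor (fin (z / 1))  is  fin (half z / 1)
half : ℤ → ℤ
half z = floor ((z / 1) ℚ.* ½)

double-reflects-≤ : ∀ u v → u ℤ.+ u ℤ.< v ℤ.+ v ℤ.+ + 2 → u ℤ.≤ v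
double-reflects-≤ u v lt with u ℤP.≤? v
... | yes u≤v = u≤v
... | no  u≰v =
  ⊥-elim (ℤP.≤⇒≯ (subst (ℤ._≤ u ℤ.+ u) (doubled v) (ℤP.+-mono-≤ 1+v≤u 1+v≤u)) lt)
  where
  1+v≤u : + 1 ℤ.+ v ℤ.≤ u
  1+v≤u = ℤP.i<j⇒suc[i]≤j (ℤP.≰⇒> u≰v)
  doubled : ∀ v → (+ 1 ℤ.+ v) ℤ.+ (+ 1 ℤ.+ v) ≡ v ℤ.+ v ℤ.+ + 2
  doubled = solve-∀

floor-of-half : ∀ p z → ↥ p ℤ.* + 2 ≡ z ℤ.* ↧ p →
  (floor p ℤ.+ floor p ℤ.≤ z) × (z ℤ.< floor p ℤ.+ floor p ℤ.+ + 2)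
floor-of-half p@(mkℚ a d _) z 2p≡z = lower , upper
  where
  D F r : ℤ
  D = ℤ.+[1+ d ]
  F = a ℤ./ D
  r = + (a ℤ.% D)
  r<D : r ℤ.< D
  r<D = ℤ.+<+ (ℤD.n%d<d a D)
  -- 2a = zD with a = r + FD gives  2F·D + 2r = z·D
  scaled : (F ℤ.+ F) ℤ.* D ℤ.+ (r ℤ.+ r) ≡ z ℤ.* D
  scaled = trans (expand r F D)
    (trans (cong (ℤ._* + 2) (sym (ℤD.a≡a%n+[a/n]*n a D))) 2p≡z)
    where
    expand : ∀ r F D → (F ℤ.+ F) ℤ.* D ℤ.+ (r ℤ.+ r) ≡ (r ℤ.+ F ℤ.* D) ℤ.* + 2
    expand = solve-∀
  lower : F ℤ.+ F ℤ.≤ z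
  lower = ℤP.*-cancelʳ-≤-pos (F ℤ.+ F) z D
    (subst ((F ℤ.+ F) ℤ.* D ℤ.≤_) scaled (ℤP.i≤i+j ((F ℤ.+ F) ℤ.* D) (r ℤ.+ r)))
  upper : z ℤ.< F ℤ.+ F ℤ.+ + 2
  upper = ℤP.*-cancelʳ-<-nonNeg D (subst₂ ℤ._<_ scaled (factor F D)
    (ℤP.+-monoʳ-< ((F ℤ.+ F) ℤ.* D) (ℤP.+-mono-< r<D r<D)))
    where
    factor : ∀ F D → (F ℤ.+ F) ℤ.* D ℤ.+ (D ℤ.+ D) ≡ (F ℤ.+ F ℤ.+ + 2) ℤ.* D
    factor = solve-∀

half-spec : ∀ z → (half z ℤ.+ half z ℤ.≤ z) × (z ℤ.< half z ℤ.+ half z ℤ.+ + 2)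
half-spec z = floor-of-half ((z / 1) ℚ.* ½) z 2half≡z
  where
  2half≡z : ↥ ((z / 1) ℚ.* ½) ℤ.* + 2 ≡ z ℤ.* ↧ ((z / 1) ℚ.* ½)
  2half≡z rewrite z/1≡integral z =
    trans (↥*↧ (integral z) ½) (cong (ℤ._* ↧ (integral z ℚ.* ½)) (ℤP.*-identityʳ z))

≤-half : ∀ e x → e ℤ.+ e ℤ.≤ x → e ℤ.≤ half x
≤-half e x le = double-reflects-≤ e (half x) (ℤP.≤-<-trans le (proj₂ (half-spec x)))

half-shift : ∀ x a y → x ℤ.≤ (a ℤ.+ a) ℤ.+ y → half x ℤ.≤ a ℤ.+ half y
half-shift x a y le = double-reflects-≤ (half x) (a ℤ.+ half y)
  (ℤP.≤-<-trans (ℤP.≤-trans (proj₁ (half-spec x)) le)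
    (subst ((a ℤ.+ a) ℤ.+ y ℤ.<_) (regroup a (half y))
      (ℤP.+-monoʳ-< (a ℤ.+ a) (proj₂ (half-spec y)))))
  where
  regroup : ∀ a h → (a ℤ.+ a) ℤ.+ (h ℤ.+ h ℤ.+ + 2) ≡ (a ℤ.+ h) ℤ.+ (a ℤ.+ h) ℤ.+ + 2
  regroup = solve-∀

double-cancel-≤ : ∀ x y → x ℤ.+ x ℤ.≤ y ℤ.+ y → x ℤ.≤ y
double-cancel-≤ x y le = double-reflects-≤ x y (ℤP.≤-<-trans le (i<i+2 (y ℤ.+ y)))
  where
  i<i+2 : ∀ i → i ℤ.< i ℤ.+ + 2
  i<i+2 i = subst (ℤ._< i ℤ.+ + 2) (ℤP.+-identityʳ i)
    (ℤP.+-monoʳ-< i (ℤ.+<+ (ℕ.s≤s ℕ.z≤n)))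

≤∞-refl : ∀ x → x ≤∞ x
≤∞-refl (fin p) = fin≤fin ℚP.≤-refl
≤∞-refl ∞ = ≤∞∞

≤∞-trans : ∀ {x y z} → x ≤∞ y → y ≤∞ z → x ≤∞ z
≤∞-trans (fin≤fin p) (fin≤fin q) = fin≤fin (ℚP.≤-trans p q)
≤∞-trans _ ≤∞∞ = ≤∞∞

≤∞-antisym : ∀ {x y} → x ≤∞ y → y ≤∞ x → x ≡ y
≤∞-antisym (fin≤fin p) (fin≤fin q) = cong fin (ℚP.≤-antisym p q)
≤∞-antisym ≤∞∞ ≤∞∞ = refl

+∞-monoʳ-≤∞ : ∀ x {y z} → y ≤∞ z → x +∞ y ≤∞ x +∞ z
+∞-monoʳ-≤∞ (fin p) (fin≤fin q) = fin≤fin (ℚP.+-monoʳ-≤ p q)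
+∞-monoʳ-≤∞ (fin p) ≤∞∞ = ≤∞∞
+∞-monoʳ-≤∞ ∞ _ = ≤∞∞

ℤ∞ : Set
ℤ∞ = ℤ ⁺

0∞ : ℤ∞
0∞ = [ + 0 ]

infixl 6 _⊕_
_⊕_ : ℤ∞ → ℤ∞ → ℤ∞
[ a ] ⊕ [ b ] = [ a ℤ.+ b ]
[ a ] ⊕ ⊤⁺    = ⊤⁺
⊤⁺    ⊕ _     = ⊤⁺

half∞ : ℤ∞ → ℤ∞
half∞ [ z ] = [ half z ]
half∞ ⊤⁺    = ⊤⁺

ι : ℤ∞ → ℚ∞
ι [ z ] = fin (z / 1)
ι ⊤⁺    = ∞

ι-half : ∀ a → ι (half∞ a) ≡ halfFloor (ι a)
ι-half [ z ] = refl
ι-half ⊤⁺    = refl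

module ≤⁺ = IsTotalOrder (≤⁺-isTotalOrder-≡ ℤP.≤-isTotalOrder)

⊕-assoc : ∀ a b c → (a ⊕ b) ⊕ c ≡ a ⊕ (b ⊕ c)
⊕-assoc [ a ] [ b ] [ c ] = cong [_] (ℤP.+-assoc a b c)
⊕-assoc [ a ] [ b ] ⊤⁺    = refl
⊕-assoc [ a ] ⊤⁺    c     = refl
⊕-assoc ⊤⁺    b     c     = refl

⊕-comm : ∀ a b → a ⊕ b ≡ b ⊕ a
⊕-comm [ a ] [ b ] = cong [_] (ℤP.+-comm a b)
⊕-comm [ a ] ⊤⁺    = refl
⊕-comm ⊤⁺    [ b ] = refl
⊕-comm ⊤⁺    ⊤⁺    = refl

⊕-identityʳ : ∀ a → a ⊕ 0∞ ≡ a
⊕-identityʳ [ a ] = cong [_] (ℤP.+-identityʳ a)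
⊕-identityʳ ⊤⁺    = refl

⊕-commutativeSemigroup : CommutativeSemigroup 0ℓ 0ℓ
⊕-commutativeSemigroup = record
  { Carrier = ℤ∞ ; _≈_ = _≡_ ; _∙_ = _⊕_
  ; isCommutativeSemigroup = record
    { isSemigroup = record
      { isMagma = record
        { isEquivalence = isEquivalence ; ∙-cong = cong₂ _⊕_ }
      ; assoc = ⊕-assoc }
    ; comm = ⊕-comm } }

open CommutativeSemigroupProperties ⊕-commutativeSemigroup
  using (interchange; x∙yz≈xz∙y)

⊕-mono-≤⁺ : ∀ {a b c d} → a ≤⁺ b → c ≤⁺ d → a ⊕ c ≤⁺ b ⊕ d
⊕-mono-≤⁺ [ p ]    [ q ]    = [ ℤP.+-mono-≤ p q ]
⊕-mono-≤⁺ [ p ]    (_ ≤⊤⁺) = _ ≤⊤⁺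
⊕-mono-≤⁺ (_ ≤⊤⁺) _        = _ ≤⊤⁺

ι-⊕ : ∀ a b → ι a +∞ ι b ≡ ι (a ⊕ b)
ι-⊕ [ a ] [ b ] = cong fin (/1-+ a b)
ι-⊕ [ a ] ⊤⁺    = refl
ι-⊕ ⊤⁺    b     = refl

ι-mono : ∀ {a b} → a ≤⁺ b → ι a ≤∞ ι b
ι-mono [ p ]    = fin≤fin (/1-mono-≤ p)
ι-mono (_ ≤⊤⁺) = ≤∞∞

ι-cancel : ∀ {a b} → ι a ≤∞ ι b → a ≤⁺ b
ι-cancel {[ a ]} {[ b ]} (fin≤fin p) = [ /1-cancel-≤ p ]
ι-cancel {a}     {⊤⁺}    _           = a ≤⊤⁺
ι-cancel {⊤⁺}    {[ b ]} ()

ι-injective : ∀ {a b} → ι a ≡ ι b → a ≡ b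
ι-injective e = ≤⁺.antisym (ι-cancel (subst (_ ≤∞_) e (≤∞-refl _)))
                           (ι-cancel (subst (_≤∞ _) e (≤∞-refl _)))

half∞-double-≤ : ∀ x → half∞ x ⊕ half∞ x ≤⁺ x
half∞-double-≤ [ z ] = [ proj₁ (half-spec z) ]
half∞-double-≤ ⊤⁺    = _ ≤⊤⁺

≤-half∞ : ∀ e x → e ⊕ e ≤⁺ x → e ≤⁺ half∞ x
≤-half∞ [ e ] [ x ] [ p ] = [ ≤-half e x p ]
≤-half∞ e     ⊤⁺    _     = _ ≤⊤⁺

half∞-shift : ∀ x a y → x ≤⁺ (a ⊕ a) ⊕ y → half∞ x ≤⁺ a ⊕ half∞ y
half∞-shift [ x ] [ a ] [ y ] [ p ] = [ half-shift x a y p ]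
half∞-shift x     [ a ] ⊤⁺    _     = _ ≤⊤⁺
half∞-shift x     ⊤⁺    y     _     = _ ≤⊤⁺

double-cancel-≤⁺ : ∀ x y → x ⊕ x ≤⁺ y ⊕ y → x ≤⁺ y
double-cancel-≤⁺ [ x ] [ y ] [ p ] = [ double-cancel-≤ x y p ]
double-cancel-≤⁺ x     ⊤⁺    _     = _ ≤⊤⁺

infixl 7 _⊓_
_⊓_ : ℤ∞ → ℤ∞ → ℤ∞
[ a ] ⊓ [ b ] = [ a ℤ.⊓ b ]
[ a ] ⊓ ⊤⁺    = [ a ]
⊤⁺    ⊓ y     = y

≤⁺-totalPreorder : TotalPreorder 0ℓ 0ℓ 0ℓ
≤⁺-totalPreorder = record { isTotalPreorder = ≤⁺.isTotalPreorder }

⊓-minOperator : MinOperator ≤⁺-totalPreorder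
⊓-minOperator = record { _⊓_ = _⊓_ ; x≤y⇒x⊓y≈x = left ; x≥y⇒x⊓y≈y = right }
  where
  left : ∀ {x y} → x ≤⁺ y → x ⊓ y ≡ x
  left [ p ]        = cong [_] (ℤP.i≤j⇒i⊓j≡i p)
  left ([ a ] ≤⊤⁺) = refl
  left (⊤⁺ ≤⊤⁺)    = refl
  right : ∀ {x y} → y ≤⁺ x → x ⊓ y ≡ y
  right [ p ]   = cong [_] (ℤP.i≥j⇒i⊓j≡j p)
  right (y ≤⊤⁺) = refl

open MinOp ⊓-minOperator using (x⊓y≤x; x⊓y≤y; ⊓-sel; ⊓-glb)
open MinOperator ⊓-minOperator using (x≤y⇒x⊓y≈x; x≥y⇒x⊓y≈y)

-- Addition distributes over minimum: (x ⊓ y) ⊕ (u ⊓ v) is one of the four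
-- sums, so a common lower bound of all four bounds it.
≤-⊓⊕⊓ : ∀ {z x y u v} → z ≤⁺ x ⊕ u → z ≤⁺ x ⊕ v → z ≤⁺ y ⊕ u → z ≤⁺ y ⊕ v →
        z ≤⁺ (x ⊓ y) ⊕ (u ⊓ v)
≤-⊓⊕⊓ {z} {x} {y} {u} {v} xu xv yu yv
  with ⊓-sel x y | ⊓-sel u v
... | Sum.inj₁ e₁ | Sum.inj₁ e₂ = subst (z ≤⁺_) (sym (cong₂ _⊕_ e₁ e₂)) xu
... | Sum.inj₁ e₁ | Sum.inj₂ e₂ = subst (z ≤⁺_) (sym (cong₂ _⊕_ e₁ e₂)) xv
... | Sum.inj₂ e₁ | Sum.inj₁ e₂ = subst (z ≤⁺_) (sym (cong₂ _⊕_ e₁ e₂)) yu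
... | Sum.inj₂ e₁ | Sum.inj₂ e₂ = subst (z ≤⁺_) (sym (cong₂ _⊕_ e₁ e₂)) yv

≤-⊕-nonneg : ∀ p q s t → 0∞ ≤⁺ t ⊕ s → p ⊕ q ≤⁺ (p ⊕ s) ⊕ (t ⊕ q)
≤-⊕-nonneg p q s t 0≤t+s = subst₂ _≤⁺_ (⊕-identityʳ (p ⊕ q)) regroup
  (⊕-mono-≤⁺ (≤⁺.refl {p ⊕ q}) 0≤t+s)
  where
  open ≡-Reasoning
  regroup : (p ⊕ q) ⊕ (t ⊕ s) ≡ (p ⊕ s) ⊕ (t ⊕ q)
  regroup = begin
    (p ⊕ q) ⊕ (t ⊕ s) ≡⟨ cong ((p ⊕ q) ⊕_) (⊕-comm t s) ⟩
    (p ⊕ q) ⊕ (s ⊕ t) ≡⟨ interchange p q s t ⟩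
    (p ⊕ s) ⊕ (q ⊕ t) ≡⟨ cong ((p ⊕ s) ⊕_) (⊕-comm q t) ⟩
    (p ⊕ s) ⊕ (t ⊕ q) ∎

fromIntW : (x : ℚ∞) → IsIntW x → Σ ℤ∞ λ a → ι a ≡ x
fromIntW x (Sum.inj₁ (z , e)) = [ z ] , sym e
fromIntW x (Sum.inj₂ e)       = ⊤⁺ , sym e

fromEvenW : (x : ℚ∞) → IsEvenW x → Σ ℤ∞ λ e → ι (e ⊕ e) ≡ x
fromEvenW x (Sum.inj₁ (z , e)) = [ z ] , sym e
fromEvenW x (Sum.inj₂ e)       = ⊤⁺ , sym e

ι-IsIntW : ∀ a → IsIntW (ι a)
ι-IsIntW [ z ] = Sum.inj₁ (z , refl)
ι-IsIntW ⊤⁺    = Sum.inj₂ refl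

ι-IsEvenW : ∀ e → IsEvenW (ι (e ⊕ e))
ι-IsEvenW [ z ] = Sum.inj₁ (z , refl)
ι-IsEvenW ⊤⁺    = Sum.inj₂ refl

bar-involutive : ∀ {n} (i : Node n) → bar (bar i) ≡ i
bar-involutive {suc n} Fin.zero             = refl
bar-involutive {suc n} (Fin.suc Fin.zero)   = refl
bar-involutive {suc n} (Fin.suc (Fin.suc i)) = cong (λ k → Fin.suc (Fin.suc k)) (bar-involutive i)

path-≥-arc : ∀ {n} (v : Graph n) → (∀ a b c → v a b ≤∞ v a c +∞ v c b) →
  ∀ a vs t → v a t ≤∞ pathW v a vs t
path-≥-arc v tri a []       t = ≤∞-refl (v a t)
path-≥-arc v tri a (b ∷ bs) t = ≤∞-trans (tri a t b) (+∞-monoʳ-≤∞ (v a b) (path-≥-arc v tri b bs t))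

closed⇒consistent : ∀ {n} (v : Graph n) → (∀ a → v a a ≡ fin 0ℚ) →
  (∀ a b c → v a b ≤∞ v a c +∞ v c b) → Consistent v
closed⇒consistent v diag tri a vs = subst (_≤∞ cycleW v a vs) (diag a) (path-≥-arc v tri a vs a)

module Candidate {n : ℕ} (w : Graph n) (closed : Closed w) (intOct : IntOctagonal w) where

  W : Node n → Node n → ℤ∞
  W i j = proj₁ (fromIntW (w i j) (proj₂ intOct i j))

  ι-W : ∀ i j → ι (W i j) ≡ w i j
  ι-W i j = proj₂ (fromIntW (w i j) (proj₂ intOct i j))

  W-coherent : ∀ i j → W i j ≡ W (bar j) (bar i)
  W-coherent i j = ι-injective (begin
    ι (W i j)             ≡⟨ ι-W i j ⟩
    w i j                 ≡⟨ proj₂ (proj₁ intOct) i j ⟩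
    w (bar j) (bar i)     ≡⟨ sym (ι-W (bar j) (bar i)) ⟩
    ι (W (bar j) (bar i)) ∎)
    where open ≡-Reasoning

  W-diagonal : ∀ a → W a a ≡ 0∞
  W-diagonal a = ι-injective (trans (ι-W a a) (proj₁ (proj₂ closed) a))

  W-triangle : ∀ a b c → W a b ≤⁺ W a c ⊕ W c b
  W-triangle a b c = ι-cancel (subst₂ _≤∞_ (sym (ι-W a b))
    (trans (cong₂ _+∞_ (sym (ι-W a c)) (sym (ι-W c b))) (ι-⊕ (W a c) (W c b)))
    (proj₂ (proj₂ closed) a b c))

  -- Routing a → ā through c → c̄, where the last leg c̄ → ā mirrors a → c.
  W-through : ∀ a c → W a (bar a) ≤⁺ (W a c ⊕ W a c) ⊕ W c (bar c)
  W-through a c = subst (W a (bar a) ≤⁺_) (x∙yz≈xz∙y (W a c) (W c (bar c)) (W a c))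
    (≤⁺.trans (W-triangle a (bar a) c)
      (⊕-mono-≤⁺ (≤⁺.refl {W a c})
        (subst (λ x → W c (bar a) ≤⁺ W c (bar c) ⊕ x) (sym (W-coherent a c))
          (W-triangle c (bar a) (bar c)))))

  halfSum : Node n → Node n → ℤ∞
  halfSum i j = half∞ (W i (bar i)) ⊕ half∞ (W (bar j) j)

  halfSum-coherent : ∀ i j → halfSum i j ≡ halfSum (bar j) (bar i)
  halfSum-coherent i j = trans (⊕-comm _ _)
    (cong₂ (λ x y → half∞ x ⊕ half∞ y)
      (cong (W (bar j)) (sym (bar-involutive j)))
      (cong (λ k → W k (bar i)) (sym (bar-involutive i))))

  ι-halfSum : ∀ i j → ι (halfSum i j) ≡ halfFloor (w i (bar i)) +∞ halfFloor (w (bar j) j)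
  ι-halfSum i j = begin
    ι (halfSum i j)
      ≡⟨ sym (ι-⊕ (half∞ (W i (bar i))) (half∞ (W (bar j) j))) ⟩
    ι (half∞ (W i (bar i))) +∞ ι (half∞ (W (bar j) j))
      ≡⟨ cong₂ _+∞_ (ι-half (W i (bar i))) (ι-half (W (bar j) j)) ⟩
    halfFloor (ι (W i (bar i))) +∞ halfFloor (ι (W (bar j) j))
      ≡⟨ cong₂ (λ x y → halfFloor x +∞ halfFloor y) (ι-W i (bar i)) (ι-W (bar j) j) ⟩
    halfFloor (w i (bar i)) +∞ halfFloor (w (bar j) j) ∎
    where open ≡-Reasoning

  half-out : ∀ a c → half∞ (W a (bar a)) ≤⁺ W a c ⊕ half∞ (W c (bar c))
  half-out a c = half∞-shift (W a (bar a)) (W a c) (W c (bar c)) (W-through a c)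

  half-in : ∀ c b → half∞ (W (bar b) b) ≤⁺ W c b ⊕ half∞ (W (bar c) c)
  half-in c b = subst₂ _≤⁺_
    (cong (λ k → half∞ (W (bar b) k)) (bar-involutive b))
    (cong₂ (λ x k → x ⊕ half∞ (W (bar c) k)) (sym (W-coherent c b)) (bar-involutive c))
    (half-out (bar b) (bar c))

  M : Node n → Node n → ℤ∞
  M i j = W i j ⊓ halfSum i j

  candidate : Graph n
  candidate i j = ι (M i j)

  even-half-bound : ∀ {x} a b → IsEvenW x → x ≤∞ w a b →
    Σ ℤ∞ λ e → (ι (e ⊕ e) ≡ x) × (e ≤⁺ half∞ (W a b))
  even-half-bound {x} a b even x≤w with fromEvenW x even
  ... | e , ι2e≡x = e , ι2e≡x ,
        ≤-half∞ e (W a b) (ι-cancel (subst₂ _≤∞_ (sym ι2e≡x) (sym (ι-W a b)) x≤w))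

  antipodal-sum : ∀ {w'} → TBelow w w' → ∀ i j →
    Σ ℤ∞ λ e → (ι (e ⊕ e) ≡ w' i (bar i) +∞ w' (bar j) j) × (e ≤⁺ halfSum i j)
  antipodal-sum {w'} ((_ , _ , even) , below) i j
    with even-half-bound i (bar i) (even i) (below i (bar i))
       | even-half-bound (bar j) j
           (subst (λ k → IsEvenW (w' (bar j) k)) (bar-involutive j) (even (bar j)))
           (below (bar j) j)
  ... | e₁ , eq₁ , le₁ | e₂ , eq₂ , le₂ = e₁ ⊕ e₂ , sum-eq , ⊕-mono-≤⁺ le₁ le₂
    where
    open ≡-Reasoning
    sum-eq : ι ((e₁ ⊕ e₂) ⊕ (e₁ ⊕ e₂)) ≡ w' i (bar i) +∞ w' (bar j) j
    sum-eq = begin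
      ι ((e₁ ⊕ e₂) ⊕ (e₁ ⊕ e₂))  ≡⟨ cong ι (interchange e₁ e₂ e₁ e₂) ⟩
      ι ((e₁ ⊕ e₁) ⊕ (e₂ ⊕ e₂))  ≡⟨ sym (ι-⊕ (e₁ ⊕ e₁) (e₂ ⊕ e₂)) ⟩
      ι (e₁ ⊕ e₁) +∞ ι (e₂ ⊕ e₂) ≡⟨ cong₂ _+∞_ eq₁ eq₂ ⟩
      w' i (bar i) +∞ w' (bar j) j ∎

  below-candidate : ∀ {w'} → TBelow w w' → ∀ i j → w' i j ≤∞ candidate i j
  below-candidate {w'} tb@(((_ , _ , strong) , (_ , int) , _) , below) i j
    with fromIntW (w' i j) (int i j) | antipodal-sum tb i j
  ... | x , ιx≡w' | e , ι2e≡sum , e≤h =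
    subst (_≤∞ candidate i j) ιx≡w' (ι-mono (⊓-glb x≤W x≤h))
    where
    x≤W : x ≤⁺ W i j
    x≤W = ι-cancel (subst₂ _≤∞_ (sym ιx≡w') (sym (ι-W i j)) (below i j))
    2x≤2e : x ⊕ x ≤⁺ e ⊕ e
    2x≤2e = ι-cancel (subst₂ _≤∞_ (trans (cong twice (sym ιx≡w')) (ι-⊕ x x)) (sym ι2e≡sum)
      (strong i j))
    x≤h : x ≤⁺ halfSum i j
    x≤h = ≤⁺.trans (double-cancel-≤⁺ x e 2x≤2e) e≤h

  -- If some tightly closed w' ⊴ w exists then h(c,c) ≥ 0: the cycle c → c̄ → c.
  halfSum-nonneg : ∀ {w'} → TBelow w w' → ∀ c → 0∞ ≤⁺ halfSum c c
  halfSum-nonneg tb@((((consistent , _) , _) , _) , _) c with antipodal-sum tb c c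
  ... | e , ι2e≡cycle , e≤h = ≤⁺.trans (double-cancel-≤⁺ 0∞ e 0≤2e) e≤h
    where
    0≤2e : 0∞ ⊕ 0∞ ≤⁺ e ⊕ e
    0≤2e = ι-cancel (subst (fin 0ℚ ≤∞_) (sym ι2e≡cycle) (consistent c (bar c ∷ [])))

  module _ (nonneg : ∀ c → 0∞ ≤⁺ halfSum c c) where

    M-diagonal : ∀ a → M a a ≡ 0∞
    M-diagonal a = trans (cong (_⊓ halfSum a a) (W-diagonal a)) (x≤y⇒x⊓y≈x (nonneg a))

    M-antipodal : ∀ a b → bar a ≡ b → M a b ≡ half∞ (W a b) ⊕ half∞ (W a b)
    M-antipodal a .(bar a) refl rewrite bar-involutive a =
      x≥y⇒x⊓y≈y (half∞-double-≤ (W a (bar a)))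

    M-coherent : ∀ i j → M i j ≡ M (bar j) (bar i)
    M-coherent i j = cong₂ _⊓_ (W-coherent i j) (halfSum-coherent i j)

    -- Each of the four ways to combine M(a,c) and M(c,b) bounds M(a,b).
    M-triangle : ∀ a b c → M a b ≤⁺ M a c ⊕ M c b
    M-triangle a b c = ≤-⊓⊕⊓ via-W via-out via-in via-halves
      where
      p = half∞ (W a (bar a))
      q = half∞ (W (bar b) b)
      s = half∞ (W (bar c) c)
      t = half∞ (W c (bar c))
      M≤h : M a b ≤⁺ p ⊕ q
      M≤h = x⊓y≤y (W a b) (p ⊕ q)
      via-W : M a b ≤⁺ W a c ⊕ W c b
      via-W = ≤⁺.trans (x⊓y≤x (W a b) (p ⊕ q)) (W-triangle a b c)
      via-out : M a b ≤⁺ W a c ⊕ (t ⊕ q)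
      via-out = ≤⁺.trans M≤h (subst (p ⊕ q ≤⁺_) (⊕-assoc (W a c) t q)
        (⊕-mono-≤⁺ (half-out a c) (≤⁺.refl {q})))
      via-in : M a b ≤⁺ (p ⊕ s) ⊕ W c b
      via-in = ≤⁺.trans M≤h (subst (p ⊕ q ≤⁺_) (x∙yz≈xz∙y p (W c b) s)
        (⊕-mono-≤⁺ (≤⁺.refl {p}) (half-in c b)))
      via-halves : M a b ≤⁺ (p ⊕ s) ⊕ (t ⊕ q)
      via-halves = ≤⁺.trans M≤h (≤-⊕-nonneg p q s t (nonneg c))

    M-strong : ∀ i j → M i j ⊕ M i j ≤⁺ M i (bar i) ⊕ M (bar j) j
    M-strong i j = subst (M i j ⊕ M i j ≤⁺_)
      (trans (interchange p q p q)
        (sym (cong₂ _⊕_ (M-antipodal i (bar i) refl)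
                        (M-antipodal (bar j) j (bar-involutive j)))))
      (⊕-mono-≤⁺ M≤h M≤h)
      where
      p = half∞ (W i (bar i))
      q = half∞ (W (bar j) j)
      M≤h : M i j ≤⁺ p ⊕ q
      M≤h = x⊓y≤y (W i j) (p ⊕ q)

    candidate-diagonal : ∀ a → candidate a a ≡ fin 0ℚ
    candidate-diagonal a = cong ι (M-diagonal a)

    candidate-triangle : ∀ a b c → candidate a b ≤∞ candidate a c +∞ candidate c b
    candidate-triangle a b c =
      subst (candidate a b ≤∞_) (sym (ι-⊕ (M a c) (M c b))) (ι-mono (M-triangle a b c))

    candidate-octagonal : Octagonal candidate
    candidate-octagonal = closed⇒consistent candidate candidate-diagonal candidate-triangle
                        , λ i j → cong ι (M-coherent i j)

    candidate-TBelow : TBelow w candidate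
    candidate-TBelow =
      ( (candidate-octagonal , closedness , strong)
      , (candidate-octagonal , integral-weights)
      , even )
      , below
      where
      closedness : Closed candidate
      closedness = proj₁ candidate-octagonal , candidate-diagonal , candidate-triangle
      strong : ∀ i j → twice (candidate i j) ≤∞ candidate i (bar i) +∞ candidate (bar j) j
      strong i j = subst₂ _≤∞_ (sym (ι-⊕ (M i j) (M i j)))
        (sym (ι-⊕ (M i (bar i)) (M (bar j) j)))
        (ι-mono (M-strong i j))
      integral-weights : ∀ i j → IsIntW (candidate i j)
      integral-weights i j = ι-IsIntW (M i j)
      even : ∀ i → IsEvenW (candidate i (bar i))
      even i = subst IsEvenW (cong ι (sym (M-antipodal i (bar i) refl)))
        (ι-IsEvenW (half∞ (W i (bar i))))
      below : candidate ⊴ w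
      below i j = subst (candidate i j ≤∞_) (ι-W i j) (ι-mono (x⊓y≤x (W i j) (halfSum i j)))

  tClosure≡candidate : ∀ {wT} → IsTClosure w wT → ∀ i j → wT i j ≡ candidate i j
  tClosure≡candidate ((_ , w₀-below) , lub) i j = ≤∞-antisym
    (proj₂ (lub i j) (candidate i j) (λ w' tb → below-candidate tb i j))
    (proj₁ (lub i j) candidate (candidate-TBelow (halfSum-nonneg w₀-below)))

-- T-closure(G) = M and M(z₁,z₂) is either W(z₁,z₂) or h(z₁,z₂).
lemma5 : (n : ℕ) → 1 ≤ n → (w wT : Graph n) →
    Closed w → IntOctagonal w →
    IsTClosure w wT → Octagonal wT →
    (z₁ z₂ : Node n) →
    (wT z₁ z₂ ≡ w z₁ z₂) ⊎
    (wT z₁ z₂ ≡ halfFloor (w z₁ (bar z₁)) +∞ halfFloor (w (bar z₂) z₂))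
lemma5 _ _ w wT closed intOct tClosure _ z₁ z₂ =
  Sum.map (λ M≡W → trans wT≡M (trans (cong ι M≡W) (ι-W z₁ z₂)))
          (λ M≡h → trans wT≡M (trans (cong ι M≡h) (ι-halfSum z₁ z₂)))
          (⊓-sel (W z₁ z₂) (halfSum z₁ z₂))
  where
  open Candidate w closed intOct
  wT≡M : wT z₁ z₂ ≡ ι (M z₁ z₂)
  wT≡M = tClosure≡candidate tClosure z₁ z₂
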